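{- Let $G$ be a finite simple undirected graph, let $X$ be a minimal separator of $G$, and let $C$ and $D$ be two full components of $G\setminus X$. Let $x\in X$, $c\in C$, $d\in D$. Let $Y$ be another minimal separator of $G$ with $c\in Y$ and $x,d\notin Y$. If $X$ is parallel to $Y$, then $x$ and $d$ belong to the same connected component of $G\setminus Y$.
   Context: For nonadjacent vertices $a,b$, a set $S\subseteq V(G)\setminus\{a,b\}$ is an $a$-$b$ separator if $a$ and $b$ lie in different components of $G\setminus S$ (the graph induced on $V(G)\setminus S$); it is a minimal $a$-$b$ separator if no proper subset is an $a$-$b$ separator; $S$ is a minimal separator of $G$ if it is a minimal $a$-$b$ separator for some pair $a,b$. A component $C$ of $G\setminus T$ is a full component if every vertex of $T$ has a neighbour in $C$. A minimal separator $S$ crosses a minimal separator $T$ if there are two components of $G\setminus T$ both of which intersect $S$; two minimal separators are parallel if they do not cross each other. -}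

module Defs where

open import Data.Nat using (ℕ)
open import Data.Fin using (Fin)
open import Data.Fin.Subset using (Subset; _∈_; _∉_; _⊂_)
open import Data.Product using (Σ; ∃; _×_; _,_)
open import Relation.Nullary using (¬_)
open import Relation.Binary.PropositionalEquality using (_≡_)

record Graph (n : ℕ) : Set₁ where
  field
    Adj    : Fin n → Fin n → Set
    sym    : ∀ {u v} → Adj u v → Adj v u
    irrefl : ∀ {u} → ¬ Adj u u

module _ {n : ℕ} (G : Graph n) where
  open Graph G

  data Conn (S : Subset n) : Fin n → Fin n → Set where
    here : ∀ {u} → u ∉ S → Conn S u u
    step : ∀ {u w v} → u ∉ S → Adj u w → Conn S w v → Conn S u v

  IsSeparator : Fin n → Fin n → Subset n → Set
  IsSeparator a b S = ¬ Adj a b × a ∉ S × b ∉ S × ¬ Conn S a b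

  IsMinimalSeparatorFor : Fin n → Fin n → Subset n → Set
  IsMinimalSeparatorFor a b S =
    IsSeparator a b S × (∀ S' → S' ⊂ S → ¬ IsSeparator a b S')

  IsMinimalSeparator : Subset n → Set
  IsMinimalSeparator S = ∃ λ a → ∃ λ b → IsMinimalSeparatorFor a b S

  IsComponent : Subset n → Subset n → Set
  IsComponent T C =
    (∃ λ u → u ∈ C)
    × (∀ u → u ∈ C → u ∉ T)
    × (∀ u v → u ∈ C → v ∈ C → Conn T u v)
    × (∀ u v → u ∈ C → Conn T u v → v ∈ C)

  IsFullComponent : Subset n → Subset n → Set
  IsFullComponent T C =
    IsComponent T C × (∀ t → t ∈ T → ∃ λ u → u ∈ C × Adj t u)

  Crosses : Subset n → Subset n → Set
  Crosses S T = ∃ λ C → ∃ λ D → IsComponent T C × IsComponent T D × ¬ C ≡ D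
    × (∃ λ u → u ∈ S × u ∈ C) × (∃ λ v → v ∈ S × v ∈ D)

  Parallel : Subset n → Subset n → Set
  Parallel S T = ¬ Crosses S T × ¬ Crosses T S

module Submission where

-- Since X and Y are parallel, Y does not cross X: at most one
-- component of G \ X meets Y.  The full component C meets Y (in c), so the
-- other full component D is disjoint from Y.  Because D is connected in
-- G \ X and none of its vertices lies in Y, D is also connected in G \ Y.
-- Finally x ∉ Y has a neighbour u in the full component D, so the walk
-- x, u, …, d witnesses that x and d lie in one component of G \ Y.

open import Defs
open import Data.Nat using (ℕ)
open import Data.Fin using (Fin)
open import Data.Fin.Subset using (Subset; _∈_; _∉_)
open import Relation.Nullary using (¬_)
open import Relation.Binary.PropositionalEquality using (_≡_)
open import Data.Product using (_,_)

module _ {n : ℕ} (G : Graph n) where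

  source-∉ : ∀ {S u v} → Conn G S u v → u ∉ S
  source-∉ (here u∉S)     = u∉S
  source-∉ (step u∉S _ _) = u∉S

  -- A walk in G \ X starting in a component D of G \ X stays inside D,
  -- so if D is disjoint from Y the same walk is a walk in G \ Y.
  walk-in-component-avoids : ∀ {X Y D} → IsComponent G X D
    → (∀ w → w ∈ D → w ∉ Y)
    → ∀ {u v} → u ∈ D → Conn G X u v → Conn G Y u v
  walk-in-component-avoids _ D∩Y=∅ u∈D (here _) = here (D∩Y=∅ _ u∈D)
  walk-in-component-avoids {D = D} compD@(_ , _ , _ , closed) D∩Y=∅ {u} u∈D
                           (step {w = w} u∉X u~w walk) =
    step (D∩Y=∅ u u∈D) u~w (walk-in-component-avoids compD D∩Y=∅ w∈D walk)
    where
    w∈D : w ∈ D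
    w∈D = closed u w u∈D (step u∉X u~w (here (source-∉ walk)))

  component-connected-avoiding : ∀ {X Y D} → IsComponent G X D
    → (∀ w → w ∈ D → w ∉ Y)
    → ∀ {u v} → u ∈ D → v ∈ D → Conn G Y u v
  component-connected-avoiding compD@(_ , _ , connected , _) D∩Y=∅ u∈D v∈D =
    walk-in-component-avoids compD D∩Y=∅ u∈D (connected _ _ u∈D v∈D)

  non-crossing-meets-one-component : ∀ {X Y C D c} → ¬ Crosses G Y X
    → IsComponent G X C → IsComponent G X D → ¬ C ≡ D
    → c ∈ Y → c ∈ C
    → ∀ w → w ∈ D → w ∉ Y
  non-crossing-meets-one-component {C = C} {D} {c} noCross compC compD C≢D
                                   c∈Y c∈C w w∈D w∈Y =
    noCross (C , D , compC , compD , C≢D , (c , c∈Y , c∈C) , (w , w∈Y , w∈D))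

lemma9 : {n : ℕ} (G : Graph n) (X C D Y : Subset n) (x c d : Fin n)
    → IsMinimalSeparator G X
    → IsFullComponent G X C → IsFullComponent G X D → ¬ C ≡ D
    → x ∈ X → c ∈ C → d ∈ D
    → IsMinimalSeparator G Y → c ∈ Y → x ∉ Y → d ∉ Y
    → Parallel G X Y
    → Conn G Y x d
lemma9 G X C D Y x c d _ (compC , _) (compD , fullD) C≢D x∈X c∈C d∈D
       _ c∈Y x∉Y _ (_ , Y-does-not-cross-X) =
  let (u , u∈D , x~u) = fullD x x∈X
  in step x∉Y x~u (component-connected-avoiding G compD D∩Y=∅ u∈D d∈D)
  where
  D∩Y=∅ : ∀ w → w ∈ D → w ∉ Y
  D∩Y=∅ = non-crossing-meets-one-component G Y-does-not-cross-X
            compC compD C≢D c∈Y c∈C
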